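{- Let $\sigma$ be a permutation of $[n]$ and let $i\in[n]$. If $i\le\sigma(i)$ then $|C_+(i)|=h_i-|A_+(i)|$; if $i>\sigma(i)$ then $|C_-(i)|=h_i-1-|A_-(i)|$.
   Context: For a permutation $\sigma$ of $[n]$ and $i\in[n]$ let $C_+(i)=\{j : j<i\le \sigma(j)<\sigma(i)\}$, $C_-(i)=\{j : j>i>\sigma(j)>\sigma(i)\}$, $A_+(i)=\{j : j<i\le\sigma(i)<\sigma(j)\}$, $A_-(i)=\{j : j>i>\sigma(i)>\sigma(j)\}$. Associate to $\sigma$ the word $c=(c_1,\dots,c_n)$ over $\{N,S,E,\bar E\}$ by: $c_i=N$ if $i<\sigma(i)$ and $i<\sigma^{ -1}(i)$; $c_i=E$ if $i\le\sigma(i)$ and $i\ge\sigma^{ -1}(i)$; $c_i=\bar E$ if $i>\sigma(i)$ and $i<\sigma^{ -1}(i)$; $c_i=S$ if $i>\sigma(i)$ and $i>\sigma^{ -1}(i)$. Set $h_i=|\{j<i : c_j=N\}|-|\{j<i: c_j=S\}|$. -}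

module Defs where

open import Data.Nat using (ℕ; _<_; _≤_; _>_; _≥_; _<?_; _≤?_)
open import Data.Nat.Properties using (_>?_; _≥?_)
open import Data.Fin using (Fin; toℕ)
open import Data.Fin.Permutation using (Permutation′; _⟨$⟩ʳ_; _⟨$⟩ˡ_)
open import Data.List using (List; length; filter)
open import Data.List.Base using ()
open import Data.Fin.Base using ()
open import Data.List using () renaming (map to lmap)
open import Data.Integer using (ℤ; +_; _-_)
open import Data.Product using (_×_)
open import Relation.Nullary using (Dec; _×-dec_)
open import Relation.Unary using (Decidable)
import Data.Fin.Base
import Data.Vec.Functional

-- Elements of [n] are modelled by Fin n (i ↦ toℕ i + 1); all definitions
-- only compare values, so the shift by one is harmless.

allFin : (n : ℕ) → List (Fin n)
allFin n = Data.List.Base.tabulate (λ i → i)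

count : {n : ℕ} {P : Fin n → Set} → Decidable P → ℕ
count {n} P? = length (filter P? (allFin n))

module _ {n : ℕ} (σ : Permutation′ n) where

  s : Fin n → ℕ
  s j = toℕ (σ ⟨$⟩ʳ j)

  sinv : Fin n → ℕ
  sinv j = toℕ (σ ⟨$⟩ˡ j)

  C₊ : Fin n → ℕ
  C₊ i = count (λ j → (toℕ j <? toℕ i) ×-dec ((toℕ i ≤? s j) ×-dec (s j <? s i)))

  C₋ : Fin n → ℕ
  C₋ i = count (λ j → (toℕ j >? toℕ i) ×-dec ((toℕ i >? s j) ×-dec (s j >? s i)))

  A₊ : Fin n → ℕ
  A₊ i = count (λ j → (toℕ j <? toℕ i) ×-dec ((toℕ i ≤? s i) ×-dec (s i <? s j)))

  A₋ : Fin n → ℕ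
  A₋ i = count (λ j → (toℕ j >? toℕ i) ×-dec ((toℕ i >? s i) ×-dec (s i >? s j)))

  -- c_j = N iff j < σ(j) and j < σ⁻¹(j);  c_j = S iff j > σ(j) and j > σ⁻¹(j)
  -- h_i = #{ j < i : c_j = N } − #{ j < i : c_j = S }
  h : Fin n → ℤ
  h i = + count (λ j → (toℕ j <? toℕ i) ×-dec ((toℕ j <? s j) ×-dec (toℕ j <? sinv j)))
      - + count (λ j → (toℕ j <? toℕ i) ×-dec ((toℕ j >? s j) ×-dec (toℕ j >? sinv j)))

-- Call j an up-crossing of i when j < i ≤ σ(j). Among the j < i, the excedances j < σ(j)
-- are the N and the non-fixed E letters, the excedance values σ⁻¹(j) < j are those same E
-- letters and the S letters, and the excedance values below i are, via j = σ(k), the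
-- excedances k < σ(k) < i; the excedances j < i are these plus the up-crossings. Hence
-- N − S counts the up-crossings, i.e. h_i = #{j : j < i ≤ σ(j)}.
-- If i ≤ σ(i), comparing σ(j) with σ(i) splits the up-crossings into C₊(i) and A₊(i).
-- If σ(i) < i: as {j : j < i} and {j : σ(j) < i} are equinumerous, there are as many
-- up-crossings as down-crossings σ(j) < i ≤ j, and these are i itself, C₋(i) and A₋(i).

module Submission where

open import Defs
open import Data.Nat using (ℕ; zero; suc; _+_; _≤_; _<_; _>_; _<?_; _≤?_)
open import Data.Nat.Properties
  using (+-0-commutativeMonoid; _>?_; <-cmp; <-irrefl; <-asym; <-trans; <-≤-trans; ≤-refl;
         ≤-trans; <⇒≤; <⇒≱; <-≤-connex; m≤n⇒m<n∨m≡n; +-comm; +-assoc; +-cancelˡ-≡)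
open import Data.Fin using (Fin; zero; suc; toℕ; _≟_)
open import Data.Fin.Properties using (toℕ-injective)
open import Data.Fin.Permutation using (Permutation′; _⟨$⟩ʳ_; _⟨$⟩ˡ_; inverseˡ; inverseʳ)
open import Data.Integer using (+_; _-_)
open import Data.Integer.Properties using (+-0-abelianGroup; pos-+)
open import Data.Product using (_×_; _,_; proj₁; proj₂)
open import Data.Sum using (_⊎_; inj₁; inj₂; [_,_])
import Data.Sum as Sum
open import Data.Bool using (if_then_else_)
open import Data.List using (length; filter; tabulate)
open import Data.List.Properties using (filter-≐)
open import Function using (_∘_)
open import Level using (0ℓ)
open import Relation.Binary using (tri<; tri≈; tri>)
open import Relation.Binary.PropositionalEquality
  using (_≡_; _≢_; refl; sym; trans; cong; cong₂; subst; module ≡-Reasoning)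
open import Relation.Nullary using (Dec; yes; no; does; _×-dec_; ¬_; contradiction)
open import Relation.Unary using (Pred; Decidable; _≐_; _∪_; _⊥_)
open import Relation.Unary.Properties using (_∪?_; ≐-refl)
open import Algebra.Properties.CommutativeMonoid.Sum +-0-commutativeMonoid
  using (sum; sum-cong-≗; ∑-distrib-+; sum-permute; sum-replicate-zero)
open import Algebra.Properties.AbelianGroup +-0-abelianGroup using (//-rightDividesʳ)

indicator : {P : Set} → Dec P → ℕ
indicator P? = if does P? then 1 else 0

indicator-∪ : {P Q R : Set} (P? : Dec P) (Q? : Dec Q) (R? : Dec R) →
              (P → Q ⊎ R) → (Q ⊎ R → P) → (Q → ¬ R) → indicator P? ≡ indicator Q? + indicator R?
indicator-∪ P? Q? R? to from disjoint with P? | Q? | R?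
... | _     | yes q | yes r = contradiction r (disjoint q)
... | yes _ | yes _ | no _  = refl
... | yes _ | no _  | yes _ = refl
... | yes p | no ¬q | no ¬r = contradiction (to p) [ ¬q , ¬r ]
... | no ¬p | yes q | no _  = contradiction (from (inj₁ q)) ¬p
... | no ¬p | no _  | yes r = contradiction (from (inj₂ r)) ¬p
... | no _  | no _  | no _  = refl

length-filter-tabulate : ∀ {n} {A : Set} {P : Pred A 0ℓ} (P? : Decidable P) (f : Fin n → A) →
                         length (filter P? (tabulate f)) ≡ sum (indicator ∘ P? ∘ f)
length-filter-tabulate {zero}  P? f = refl
length-filter-tabulate {suc n} P? f with P? (f zero)
... | yes _ = cong suc (length-filter-tabulate P? (f ∘ suc))
... | no _  = length-filter-tabulate P? (f ∘ suc)

sum-indicator-≟ : ∀ {n} (i : Fin n) → sum (indicator ∘ (_≟ i)) ≡ 1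
sum-indicator-≟ {suc n} zero    = cong suc (sum-replicate-zero n)
sum-indicator-≟ {suc n} (suc i) = sum-indicator-≟ i

module _ {n : ℕ} where

  count≡sum : {P : Pred (Fin n) 0ℓ} (P? : Decidable P) → count P? ≡ sum (indicator ∘ P?)
  count≡sum P? = length-filter-tabulate P? (λ j → j)

  count-∪ : {P Q R : Pred (Fin n) 0ℓ} (P? : Decidable P) (Q? : Decidable Q) (R? : Decidable R) →
            P ≐ Q ∪ R → Q ⊥ R → count P? ≡ count Q? + count R?
  count-∪ P? Q? R? (P⊆Q∪R , Q∪R⊆P) Q⊥R = begin
    count P?                                        ≡⟨ count≡sum P? ⟩
    sum (indicator ∘ P?)                            ≡⟨ sum-cong-≗ indicator-∪-at ⟩
    sum (λ j → indicator (Q? j) + indicator (R? j)) ≡⟨ ∑-distrib-+ (indicator ∘ Q?) (indicator ∘ R?) ⟩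
    sum (indicator ∘ Q?) + sum (indicator ∘ R?)     ≡⟨ cong₂ _+_ (count≡sum Q?) (count≡sum R?) ⟨
    count Q? + count R?                             ∎
    where
    open ≡-Reasoning
    indicator-∪-at : ∀ j → indicator (P? j) ≡ indicator (Q? j) + indicator (R? j)
    indicator-∪-at j = indicator-∪ (P? j) (Q? j) (R? j) P⊆Q∪R Q∪R⊆P (λ q r → Q⊥R (q , r))

  count-≐ : {P Q : Pred (Fin n) 0ℓ} (P? : Decidable P) (Q? : Decidable Q) → P ≐ Q → count P? ≡ count Q?
  count-≐ P? Q? P≐Q = cong length (filter-≐ P? Q? P≐Q (allFin n))

  count-permute : {P : Pred (Fin n) 0ℓ} (P? : Decidable P) (π : Permutation′ n) →
                  count (P? ∘ (π ⟨$⟩ʳ_)) ≡ count P?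
  count-permute P? π = begin
    count (P? ∘ (π ⟨$⟩ʳ_))            ≡⟨ count≡sum (P? ∘ (π ⟨$⟩ʳ_)) ⟩
    sum (indicator ∘ P? ∘ (π ⟨$⟩ʳ_))  ≡⟨ sum-permute (indicator ∘ P?) π ⟨
    sum (indicator ∘ P?)              ≡⟨ count≡sum P? ⟨
    count P?                          ∎
    where open ≡-Reasoning

  count-≡ : (i : Fin n) → count (_≟ i) ≡ 1
  count-≡ i = trans (count≡sum (_≟ i)) (sum-indicator-≟ i)

≢⇒<⊎> : ∀ {m n : ℕ} → m ≢ n → m < n ⊎ n < m
≢⇒<⊎> {m} {n} m≢n with <-cmp m n
... | tri< m<n _ _ = inj₁ m<n
... | tri≈ _ m≡n _ = contradiction m≡n m≢n
... | tri> _ _ n<m = inj₂ n<m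

+[m+n]-n≡m : ∀ m n → + (m + n) - + n ≡ + m
+[m+n]-n≡m m n = trans (cong (_- + n) (pos-+ m n)) (//-rightDividesʳ (+ n) (+ m))

module _ {n : ℕ} (σ : Permutation′ n) where

  s-injective : ∀ {j k} → s σ j ≡ s σ k → j ≡ k
  s-injective {j} {k} e = begin
    j                        ≡⟨ inverseˡ σ ⟨
    σ ⟨$⟩ˡ (σ ⟨$⟩ʳ j)        ≡⟨ cong (σ ⟨$⟩ˡ_) (toℕ-injective e) ⟩
    σ ⟨$⟩ˡ (σ ⟨$⟩ʳ k)        ≡⟨ inverseˡ σ ⟩
    k                        ∎
    where open ≡-Reasoning

  sinv-s : ∀ j → sinv σ (σ ⟨$⟩ʳ j) ≡ toℕ j
  sinv-s j = cong toℕ (inverseˡ σ)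

  fixed-sinv⇒fixed-s : ∀ {j} → toℕ j ≡ sinv σ j → toℕ j ≡ s σ j
  fixed-sinv⇒fixed-s e = cong toℕ (sym (trans (cong (σ ⟨$⟩ʳ_) (toℕ-injective e)) (inverseʳ σ)))

  fixed-s⇒fixed-sinv : ∀ {j} → toℕ j ≡ s σ j → toℕ j ≡ sinv σ j
  fixed-s⇒fixed-sinv e = cong toℕ (sym (trans (cong (σ ⟨$⟩ˡ_) (toℕ-injective e)) (inverseˡ σ)))

  module _ (i : Fin n) where

    north? : Decidable (λ j → toℕ j < toℕ i × (toℕ j < s σ j × toℕ j < sinv σ j))
    north? j = (toℕ j <? toℕ i) ×-dec ((toℕ j <? s σ j) ×-dec (toℕ j <? sinv σ j))

    south? : Decidable (λ j → toℕ j < toℕ i × (toℕ j > s σ j × toℕ j > sinv σ j))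
    south? j = (toℕ j <? toℕ i) ×-dec ((toℕ j >? s σ j) ×-dec (toℕ j >? sinv σ j))

    east? : Decidable (λ j → toℕ j < toℕ i × (toℕ j < s σ j × sinv σ j < toℕ j))
    east? j = (toℕ j <? toℕ i) ×-dec ((toℕ j <? s σ j) ×-dec (sinv σ j <? toℕ j))

    excedance? : Decidable (λ j → toℕ j < toℕ i × toℕ j < s σ j)
    excedance? j = (toℕ j <? toℕ i) ×-dec (toℕ j <? s σ j)

    excedanceValue? : Decidable (λ j → toℕ j < toℕ i × sinv σ j < toℕ j)
    excedanceValue? j = (toℕ j <? toℕ i) ×-dec (sinv σ j <? toℕ j)

    innerArc? : Decidable (λ j → s σ j < toℕ i × toℕ j < s σ j)
    innerArc? j = (s σ j <? toℕ i) ×-dec (toℕ j <? s σ j)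

    left? : Decidable (λ (j : Fin n) → toℕ j < toℕ i)
    left? j = toℕ j <? toℕ i

    bothLeft? : Decidable (λ j → toℕ j < toℕ i × s σ j < toℕ i)
    bothLeft? j = (toℕ j <? toℕ i) ×-dec (s σ j <? toℕ i)

    upCrossing? : Decidable (λ j → toℕ j < toℕ i × toℕ i ≤ s σ j)
    upCrossing? j = (toℕ j <? toℕ i) ×-dec (toℕ i ≤? s σ j)

    upCrossings : ℕ
    upCrossings = count upCrossing?

    downCrossing? : Decidable (λ j → toℕ i ≤ toℕ j × s σ j < toℕ i)
    downCrossing? j = (toℕ i ≤? toℕ j) ×-dec (s σ j <? toℕ i)

    downCrossings : ℕ
    downCrossings = count downCrossing?

    C₊? : Decidable (λ j → toℕ j < toℕ i × (toℕ i ≤ s σ j × s σ j < s σ i))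
    C₊? j = (toℕ j <? toℕ i) ×-dec ((toℕ i ≤? s σ j) ×-dec (s σ j <? s σ i))

    A₊? : Decidable (λ j → toℕ j < toℕ i × (toℕ i ≤ s σ i × s σ i < s σ j))
    A₊? j = (toℕ j <? toℕ i) ×-dec ((toℕ i ≤? s σ i) ×-dec (s σ i <? s σ j))

    C₋? : Decidable (λ j → toℕ j > toℕ i × (toℕ i > s σ j × s σ j > s σ i))
    C₋? j = (toℕ j >? toℕ i) ×-dec ((toℕ i >? s σ j) ×-dec (s σ j >? s σ i))

    A₋? : Decidable (λ j → toℕ j > toℕ i × (toℕ i > s σ i × s σ i > s σ j))
    A₋? j = (toℕ j >? toℕ i) ×-dec ((toℕ i >? s σ i) ×-dec (s σ i >? s σ j))

    excedances≡north+east : count excedance? ≡ count north? + count east?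
    excedances≡north+east = count-∪ excedance? north? east?
      ( (λ {j} (j<i , j<σj) → Sum.map (λ j<σ⁻¹j → j<i , j<σj , j<σ⁻¹j) (λ σ⁻¹j<j → j<i , j<σj , σ⁻¹j<j)
                                (≢⇒<⊎> λ e → <-irrefl (fixed-sinv⇒fixed-s e) j<σj))
      , [ (λ (j<i , j<σj , _) → j<i , j<σj) , (λ (j<i , j<σj , _) → j<i , j<σj) ] )
      (λ ((_ , _ , j<σ⁻¹j) , (_ , _ , σ⁻¹j<j)) → <-asym j<σ⁻¹j σ⁻¹j<j)

    excedanceValues≡east+south : count excedanceValue? ≡ count east? + count south?
    excedanceValues≡east+south = count-∪ excedanceValue? east? south?
      ( (λ {j} (j<i , σ⁻¹j<j) → Sum.map (λ j<σj → j<i , j<σj , σ⁻¹j<j) (λ σj<j → j<i , σj<j , σ⁻¹j<j)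
                                  (≢⇒<⊎> λ e → <-irrefl (sym (fixed-s⇒fixed-sinv e)) σ⁻¹j<j))
      , [ (λ (j<i , _ , σ⁻¹j<j) → j<i , σ⁻¹j<j) , (λ (j<i , _ , σ⁻¹j<j) → j<i , σ⁻¹j<j) ] )
      (λ ((_ , j<σj , _) , (_ , σj<j , _)) → <-asym j<σj σj<j)

    excedanceValues≡innerArcs : count excedanceValue? ≡ count innerArc?
    excedanceValues≡innerArcs = trans (sym (count-permute excedanceValue? σ))
      (count-≐ (excedanceValue? ∘ (σ ⟨$⟩ʳ_)) innerArc?
        ( (λ {k} (σk<i , k<σk) → σk<i , subst (_< s σ k) (sinv-s k) k<σk)
        , (λ {k} (σk<i , k<σk) → σk<i , subst (_< s σ k) (sym (sinv-s k)) k<σk) ))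

    excedances≡innerArcs+upCrossings : count excedance? ≡ count innerArc? + upCrossings
    excedances≡innerArcs+upCrossings = count-∪ excedance? innerArc? upCrossing?
      ( (λ {j} (j<i , j<σj) → Sum.map (_, j<σj) (λ i≤σj → j<i , i≤σj) (<-≤-connex (s σ j) (toℕ i)))
      , [ (λ (σj<i , j<σj) → <-trans j<σj σj<i , j<σj) , (λ (j<i , i≤σj) → j<i , <-≤-trans j<i i≤σj) ] )
      (λ ((σj<i , _) , (_ , i≤σj)) → <⇒≱ σj<i i≤σj)

    north≡upCrossings+south : count north? ≡ upCrossings + count south?
    north≡upCrossings+south = +-cancelˡ-≡ Z _ _ (begin
      Z + N        ≡⟨ +-comm Z N ⟩
      N + Z        ≡⟨ cong (λ k → N + k) excedanceValues≡east+south ⟩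
      N + (E + S)  ≡⟨ +-assoc N E S ⟨
      N + E + S    ≡⟨ cong (_+ S) excedances≡north+east ⟨
      X + S        ≡⟨ cong (_+ S) excedances≡innerArcs+upCrossings ⟩
      W + G + S    ≡⟨ +-assoc W G S ⟩
      W + (G + S)  ≡⟨ cong (_+ (G + S)) excedanceValues≡innerArcs ⟨
      Z + (G + S)  ∎)
      where
      open ≡-Reasoning
      N S E X Z W G : ℕ
      N = count north?
      S = count south?
      E = count east?
      X = count excedance?
      Z = count excedanceValue?
      W = count innerArc?
      G = upCrossings

    h≡upCrossings : h σ i ≡ + upCrossings
    h≡upCrossings = begin
      h σ i                                           ≡⟨⟩
      + count north? - + count south?                 ≡⟨ cong (λ k → + k - + count south?) north≡upCrossings+south ⟩
      + (upCrossings + count south?) - + count south? ≡⟨ +[m+n]-n≡m upCrossings (count south?) ⟩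
      + upCrossings                                   ∎
      where open ≡-Reasoning

    upCrossings≡C₊+A₊ : toℕ i ≤ s σ i → upCrossings ≡ C₊ σ i + A₊ σ i
    upCrossings≡C₊+A₊ i≤σi = count-∪ upCrossing? C₊? A₊?
      ( (λ {j} (j<i , i≤σj) → Sum.map (λ σj<σi → j<i , i≤σj , σj<σi) (λ σi<σj → j<i , i≤σi , σi<σj)
                                (≢⇒<⊎> λ e → <-irrefl (cong toℕ (s-injective e)) j<i))
      , [ (λ (j<i , i≤σj , _) → j<i , i≤σj) , (λ (j<i , i≤σi , σi<σj) → j<i , ≤-trans i≤σi (<⇒≤ σi<σj)) ] )
      (λ ((_ , _ , σj<σi) , (_ , _ , σi<σj)) → <-asym σj<σi σi<σj)

    upCrossings≡downCrossings : upCrossings ≡ downCrossings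
    upCrossings≡downCrossings = +-cancelˡ-≡ (count bothLeft?) _ _ (begin
      count bothLeft? + upCrossings    ≡⟨ left≡bothLeft+upCrossings ⟨
      count left?                      ≡⟨ count-permute left? σ ⟨
      count (left? ∘ (σ ⟨$⟩ʳ_))        ≡⟨ leftImage≡bothLeft+downCrossings ⟩
      count bothLeft? + downCrossings  ∎)
      where
      open ≡-Reasoning
      left≡bothLeft+upCrossings : count left? ≡ count bothLeft? + upCrossings
      left≡bothLeft+upCrossings = count-∪ left? bothLeft? upCrossing?
        ( (λ {j} j<i → Sum.map (j<i ,_) (j<i ,_) (<-≤-connex (s σ j) (toℕ i)))
        , [ proj₁ , proj₁ ] )
        (λ ((_ , σj<i) , (_ , i≤σj)) → <⇒≱ σj<i i≤σj)
      leftImage≡bothLeft+downCrossings : count (left? ∘ (σ ⟨$⟩ʳ_)) ≡ count bothLeft? + downCrossings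
      leftImage≡bothLeft+downCrossings = count-∪ (left? ∘ (σ ⟨$⟩ʳ_)) bothLeft? downCrossing?
        ( (λ {j} σj<i → Sum.map (_, σj<i) (_, σj<i) (<-≤-connex (toℕ j) (toℕ i)))
        , [ proj₂ , proj₂ ] )
        (λ ((j<i , _) , (i≤j , _)) → <⇒≱ j<i i≤j)

    downCrossings≡C₋∪A₋+[i] : s σ i < toℕ i → downCrossings ≡ count (C₋? ∪? A₋?) + count (_≟ i)
    downCrossings≡C₋∪A₋+[i] σi<i = count-∪ downCrossing? (C₋? ∪? A₋?) (_≟ i)
      ( (λ {j} (i≤j , σj<i) →
          [ (λ i<j → inj₁ (Sum.map (λ σi<σj → i<j , σj<i , σi<σj) (λ σj<σi → i<j , σi<i , σj<σi)
                             (≢⇒<⊎> λ e → <-irrefl (cong toℕ (s-injective e)) i<j)))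
          , (λ i≡j → inj₂ (toℕ-injective (sym i≡j))) ] (m≤n⇒m<n∨m≡n i≤j))
      , [ [ (λ (i<j , σj<i , _) → <⇒≤ i<j , σj<i)
          , (λ (i<j , σi<i , σj<σi) → <⇒≤ i<j , <-trans σj<σi σi<i) ]
        , (λ { refl → ≤-refl , σi<i }) ] )
      (λ { (inj₁ (i<i , _) , refl) → <-irrefl refl i<i ; (inj₂ (i<i , _) , refl) → <-irrefl refl i<i })

    C₋∪A₋≡C₋+A₋ : count (C₋? ∪? A₋?) ≡ C₋ σ i + A₋ σ i
    C₋∪A₋≡C₋+A₋ = count-∪ (C₋? ∪? A₋?) C₋? A₋? ≐-refl
      (λ ((_ , _ , σi<σj) , (_ , _ , σj<σi)) → <-asym σi<σj σj<σi)

    downCrossings≡C₋+A₋+1 : s σ i < toℕ i → downCrossings ≡ C₋ σ i + A₋ σ i + 1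
    downCrossings≡C₋+A₋+1 σi<i =
      trans (downCrossings≡C₋∪A₋+[i] σi<i) (cong₂ _+_ C₋∪A₋≡C₋+A₋ (count-≡ i))

lemma1 : (n : ℕ) (σ : Permutation′ n) (i : Fin n) →
         ((toℕ i ≤ toℕ (σ ⟨$⟩ʳ i)) → + C₊ σ i ≡ h σ i - + A₊ σ i)
         × ((toℕ i > toℕ (σ ⟨$⟩ʳ i)) → + C₋ σ i ≡ h σ i - + 1 - + A₋ σ i)
lemma1 _ σ i = ascent , descent
  where
  open ≡-Reasoning
  ascent : toℕ i ≤ s σ i → + C₊ σ i ≡ h σ i - + A₊ σ i
  ascent i≤σi = begin
    + C₊ σ i                          ≡⟨ +[m+n]-n≡m (C₊ σ i) (A₊ σ i) ⟨
    + (C₊ σ i + A₊ σ i) - + A₊ σ i    ≡⟨ cong (λ k → + k - + A₊ σ i) (upCrossings≡C₊+A₊ σ i i≤σi) ⟨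
    + upCrossings σ i - + A₊ σ i      ≡⟨ cong (_- + A₊ σ i) (h≡upCrossings σ i) ⟨
    h σ i - + A₊ σ i                  ∎
  descent : s σ i < toℕ i → + C₋ σ i ≡ h σ i - + 1 - + A₋ σ i
  descent σi<i = begin
    + C₋ σ i                                    ≡⟨ +[m+n]-n≡m (C₋ σ i) (A₋ σ i) ⟨
    + (C₋ σ i + A₋ σ i) - + A₋ σ i              ≡⟨ cong (_- + A₋ σ i) (+[m+n]-n≡m (C₋ σ i + A₋ σ i) 1) ⟨
    + (C₋ σ i + A₋ σ i + 1) - + 1 - + A₋ σ i    ≡⟨ cong (λ k → + k - + 1 - + A₋ σ i) crossings ⟨
    + upCrossings σ i - + 1 - + A₋ σ i          ≡⟨ cong (λ k → k - + 1 - + A₋ σ i) (h≡upCrossings σ i) ⟨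
    h σ i - + 1 - + A₋ σ i                      ∎
    where
    crossings : upCrossings σ i ≡ C₋ σ i + A₋ σ i + 1
    crossings = trans (upCrossings≡downCrossings σ i) (downCrossings≡C₋+A₋+1 σ i σi<i)
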